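{- Let $t\ge 1$ and $\pi\in\mathfrak{S}_n(213)$. Then $\pi$ is $t$-stack-sortable if and only if $\mathsf{lrrp}(\lambda(\pi))\le t$.
   Context: $\mathfrak{S}_n(213)$ is the set of permutations of $[n]$ with no subsequence order-isomorphic to $213$. The stack-sorting map $\mathcal{S}$ is defined recursively on words with distinct letters by $\mathcal{S}(\emptyset)=\emptyset$ and, writing $w=\alpha\, m\,\beta$ with $m$ the largest letter, $\mathcal{S}(w)=\mathcal{S}(\alpha)\mathcal{S}(\beta)m$; $\pi$ is $t$-stack-sortable if $\mathcal{S}^t(\pi)$ is the identity. For a word $w$ of distinct positive integers, $\lambda(\emptyset)$ is the empty tree and, writing $w=\sigma\, i\,\tau$ with $i$ the smallest letter, $\lambda(w)$ is the binary tree with root $i$, left subtree $\lambda(\sigma)$ and right subtree $\lambda(\tau)$ (an increasing binary tree). For a binary tree $T$, the right arm is the maximal path starting at the root using only right edges (going to right children). A restricted path is a (downward) path in $T$ containing no node of the right arm. A longest restricted right path is a restricted path containing the maximum possible number of right edges. $\mathsf{lrrp}(T)$ is one plus the number of right edges in a longest restricted right path, with the convention $\mathsf{lrrp}(T)=0$ if $T$ has no left edges. -}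

module Defs where

open import Data.Nat using (ℕ; zero; suc; _+_; _⊔_; _⊓_; _<_; _≟_)
open import Data.Nat.Base using (_<ᵇ_)
open import Data.Bool using (Bool; true; false; if_then_else_; _∨_)
open import Data.List using (List; []; _∷_; _++_; map; foldr; length; takeWhile; drop; concatMap; applyUpTo; filter)
open import Data.List.Relation.Binary.Sublist.Propositional using (_⊆_)
open import Data.List.Relation.Binary.Permutation.Propositional using (_↭_)
open import Data.Product using (Σ; _×_; ∃)
open import Relation.Nullary using (¬_; ¬?)
open import Function using (_∘_)
open import Relation.Binary.PropositionalEquality using (_≡_)

idPerm : ℕ → List ℕ
idPerm n = applyUpTo suc n

IsPermOf : ℕ → List ℕ → Set
IsPermOf n π = π ↭ idPerm n

Avoids213 : List ℕ → Set
Avoids213 π = ¬ (Σ ℕ λ a → Σ ℕ λ b → Σ ℕ λ c →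
                 ((a ∷ b ∷ c ∷ []) ⊆ π) × (b < a) × (a < c))

before : ℕ → List ℕ → List ℕ
before m w = takeWhile (λ x → ¬? (x ≟ m)) w

after : ℕ → List ℕ → List ℕ
after m w = drop (suc (length (before m w))) w

-- stack-sorting map S, with a fuel argument guaranteeing termination
-- (fuel = length of the word suffices since α, β are strictly shorter)
stackSortF : ℕ → List ℕ → List ℕ
stackSortF zero    w        = []
stackSortF (suc k) []       = []
stackSortF (suc k) (x ∷ xs) =
  let m = foldr _⊔_ x xs
      w = x ∷ xs
  in stackSortF k (before m w) ++ stackSortF k (after m w) ++ (m ∷ [])

stackSort : List ℕ → List ℕ
stackSort w = stackSortF (length w) w

stackSortIter : ℕ → List ℕ → List ℕ
stackSortIter zero    w = w
stackSortIter (suc t) w = stackSortIter t (stackSort w)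

TStackSortable : ℕ → ℕ → List ℕ → Set
TStackSortable t n π = stackSortIter t π ≡ idPerm n

data Tree : Set where
  leaf : Tree
  node : Tree → ℕ → Tree → Tree

lamF : ℕ → List ℕ → Tree
lamF zero    w        = leaf
lamF (suc k) []       = leaf
lamF (suc k) (x ∷ xs) =
  let i = foldr _⊓_ x xs
      w = x ∷ xs
  in node (lamF k (before i w)) i (lamF k (after i w))

lam : List ℕ → Tree
lam w = lamF (length w) w

-- downward paths, as the sequences of edge directions taken from a starting node
data Dir : Set where
  L R : Dir

pathsFrom : Tree → List (List Dir)
pathsFrom leaf         = []
pathsFrom (node l x r) = [] ∷ (map (L ∷_) (pathsFrom l) ++ map (R ∷_) (pathsFrom r))

subtrees : Tree → List Tree
subtrees leaf           = []
subtrees (node l x r)   = node l x r ∷ (subtrees l ++ subtrees r)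

offArm : Tree → List Tree
offArm leaf         = []
offArm (node l x r) = subtrees l ++ offArm r

-- all restricted paths (downward paths avoiding the right arm)
restrictedPaths : Tree → List (List Dir)
restrictedPaths T = concatMap pathsFrom (offArm T)

isR : Dir → Bool
isR L = false
isR R = true

rightEdges : List Dir → ℕ
rightEdges []      = 0
rightEdges (d ∷ p) = (if isR d then 1 else 0) + rightEdges p

isNode : Tree → Bool
isNode leaf = false
isNode (node _ _ _) = true

hasLeftEdge : Tree → Bool
hasLeftEdge leaf         = false
hasLeftEdge (node l x r) = isNode l ∨ hasLeftEdge l ∨ hasLeftEdge r

maxList : List ℕ → ℕ
maxList = foldr _⊔_ 0

lrrp : Tree → ℕ
lrrp T = if hasLeftEdge T then suc (maxList (map rightEdges (restrictedPaths T))) else 0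

-- The tree T = λ(π) of a 213-avoiding permutation π is layered: its in-order word is π, labels
-- increase downwards, and each left subtree lies entirely above its sibling right subtree.
-- A word made of the in-order word of such a tree followed by an increasing tail above its right
-- arm keeps this shape under stack sorting: the new tree is obtained by deleting, inside every
-- left subtree hanging off the right arm, each node without a right child.  This lowers the right
-- depth (the largest number of right edges on a downward path) of each such subtree by one, and
-- the word is increasing exactly when all of them are empty.  So π is t-stack-sortable iff every
-- left subtree of the arm has right depth below t, which is lrrp(T) ≤ t.

module Submission where

open import Defs
open import Data.Bool using (true; false; T)
open import Data.List using (List; []; _∷_; _++_; length; foldr; map; concat; concatMap)
open import Data.List.Properties using (length-++; ++-assoc; ++-identityʳ; ∷-injective; map-++; map-∘; concat-++)
open import Data.List.Membership.Propositional using (_∈_; _∉_)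
open import Data.List.Membership.Propositional.Properties using (∈-++⁺ʳ; ∈-++⁻; foldr-selective)
open import Data.List.Relation.Unary.Any using (here; there)
open import Data.List.Relation.Unary.All as All using (All; []; _∷_)
open import Data.List.Relation.Unary.All.Properties as All using (All¬⇒¬Any)
open import Data.List.Relation.Unary.AllPairs as AllPairs using (AllPairs; []; _∷_)
import Data.List.Relation.Unary.AllPairs.Properties as AllPairsₚ
open import Data.List.Relation.Unary.Linked as Linked using ()
open import Data.List.Relation.Unary.Linked.Properties using (AllPairs⇒Linked)
open import Data.List.Relation.Unary.Sorted.TotalOrder.Properties using (↗↭↗⇒≋)
open import Data.List.Relation.Unary.Unique.Propositional using (Unique)
open import Data.List.Relation.Binary.Pointwise using (Pointwise-≡⇒≡)
open import Data.List.Relation.Binary.Permutation.Propositional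
  using (_↭_; ↭-refl; ↭-sym; ↭-trans; ↭-reflexive; ↭⇒↭ₛ; module PermutationReasoning)
open import Data.List.Relation.Binary.Permutation.Propositional.Properties as ↭ using (∷↭∷ʳ; All-resp-↭)
open import Data.List.Relation.Binary.Subset.Propositional using (_⊆_)
open import Data.List.Relation.Binary.Subset.Propositional.Properties as ⊆ using (xs⊆xs++ys; xs⊆ys++xs)
open import Data.List.Relation.Binary.Sublist.Propositional as Sublist using () renaming (_⊆_ to _⊑_)
import Data.List.Relation.Binary.Sublist.Propositional.Properties as Sublistₚ
open import Data.Nat using (ℕ; zero; suc; _≤_; _<_; _≥_; _∸_; _⊔_; _⊓_; _≡ᵇ_; _≟_; z≤n; s≤s; s≤s⁻¹)
open import Data.Nat.Properties
open import Data.Nat.GeneralisedArithmetic using (iterate)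
open import Data.Product using (Σ; ∃-syntax; _×_; _,_; proj₁; proj₂)
open import Data.Product.Function.NonDependent.Propositional using (_×-⇔_)
open import Data.Sum using (inj₁; inj₂; [_,_]′)
open import Function using (_∘_)
open import Function.Bundles using (_⇔_; mk⇔)
open import Function.Properties.Equivalence using (⇔-setoid)
open import Level using (0ℓ)
open import Relation.Binary.PropositionalEquality
open import Data.List.Relation.Binary.Permutation.Setoid.Properties (setoid ℕ) using (Unique-resp-↭)
import Relation.Binary.Reasoning.Setoid as SetoidReasoning
open import Relation.Nullary using (yes; no; contradiction)

-- Words

Increasing : List ℕ → Set
Increasing = AllPairs _<_

infix 4 _≪_
_≪_ : List ℕ → List ℕ → Set
xs ≪ ys = All (λ x → All (x <_) ys) xs

AllPairs-++⁻ : ∀ {R : ℕ → ℕ → Set} xs {ys} → AllPairs R (xs ++ ys) →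
               AllPairs R xs × AllPairs R ys × All (λ x → All (R x) ys) xs
AllPairs-++⁻ []       pys          = [] , pys , []
AllPairs-++⁻ (x ∷ xs) (rx ∷ pxys) with AllPairs-++⁻ xs pxys
... | pxs , pys , cross = All.++⁻ˡ xs rx ∷ pxs , pys , All.++⁻ʳ xs rx ∷ cross

≪-lookup : ∀ {xs ys y} → xs ≪ ys → y ∈ ys → All (_< y) xs
≪-lookup xs≪ys y∈ = All.map (λ x<ys → All.lookup x<ys y∈) xs≪ys

below-max : ∀ {M xs} → All (_≤ M) xs → M ∉ xs → All (_< M) xs
below-max {xs = xs} ≤M M∉ = All.tabulate λ x∈ →
  ≤∧≢⇒< (All.lookup ≤M x∈) (λ x≡M → M∉ (subst (_∈ xs) x≡M x∈))

above-min : ∀ {i xs} → All (_≥ i) xs → i ∉ xs → All (i <_) xs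
above-min {xs = xs} ≥i i∉ = All.tabulate λ x∈ →
  ≤∧≢⇒< (All.lookup ≥i x∈) (λ i≡x → i∉ (subst (_∈ xs) (sym i≡x) x∈))

snoc-increasing : ∀ {σ M} → Increasing σ → All (_< M) σ → Increasing (σ ++ M ∷ [])
snoc-increasing σ↑ σ<M = AllPairsₚ.++⁺ σ↑ ([] ∷ []) (All.map (_∷ []) σ<M)

∉-∷ : ∀ {a M α} → a < M → M ∉ α → M ∉ a ∷ α
∉-∷ a<M M∉α (here M≡a)  = <⇒≢ a<M (sym M≡a)
∉-∷ a<M M∉α (there M∈α) = M∉α M∈α

Unique-∉ : ∀ {M} xs {ys} → Unique (xs ++ M ∷ ys) → M ∉ xs
Unique-∉ xs u M∈xs with AllPairs-++⁻ xs u
... | _ , _ , cross = All.lookup (All.lookup cross M∈xs) (here refl) refl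

split-unique : ∀ {M} α α′ {β β′ : List ℕ} → M ∉ α → M ∉ α′ → α ++ M ∷ β ≡ α′ ++ M ∷ β′ → α ≡ α′ × β ≡ β′
split-unique []      []       _   _    refl = refl , refl
split-unique []      (a ∷ α′) _   M∉α′ eq   = contradiction (here (proj₁ (∷-injective eq))) M∉α′
split-unique (a ∷ α) []       M∉α _    eq   = contradiction (here (sym (proj₁ (∷-injective eq)))) M∉α
split-unique (a ∷ α) (_ ∷ α′) M∉α M∉α′ eq with ∷-injective eq
... | refl , eq′ with split-unique α α′ (M∉α ∘ there) (M∉α′ ∘ there) eq′
...   | refl , refl = refl , refl

before-∷-≢ : ∀ {m x} xs → x ≢ m → before m (x ∷ xs) ≡ x ∷ before m xs
before-∷-≢ {m} {x} xs x≢m with x ≡ᵇ m in eq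
... | false = refl
... | true  = contradiction (≡ᵇ⇒≡ x m (subst T (sym eq) _)) x≢m

before-∷-≡ : ∀ m xs → before m (m ∷ xs) ≡ []
before-∷-≡ m xs with m ≡ᵇ m in eq
... | true  = refl
... | false = contradiction (subst T eq (≡⇒≡ᵇ m m refl)) λ ()

before-++ : ∀ {m} α β → m ∉ α → before m (α ++ m ∷ β) ≡ α
before-++ {m} []      β _   = before-∷-≡ m β
before-++ {m} (a ∷ α) β m∉ =
  trans (before-∷-≢ (α ++ m ∷ β) (λ a≡m → m∉ (here (sym a≡m))))
        (cong (a ∷_) (before-++ α β (λ m∈ → m∉ (there m∈))))

after-++ : ∀ {m} α β → m ∉ α → after m (α ++ m ∷ β) ≡ β
after-++ {m} α β m∉ rewrite before-++ α β m∉ = drop-α α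
  where
  drop-α : ∀ α → Data.List.drop (suc (length α)) (α ++ m ∷ β) ≡ β
  drop-α []      = refl
  drop-α (_ ∷ α) = drop-α α

first-occurrence : ∀ {m w} → m ∈ w → Σ (List ℕ) λ α → Σ (List ℕ) λ β → m ∉ α × w ≡ α ++ m ∷ β
first-occurrence {m} {x ∷ xs} m∈ with x ≟ m | m∈
... | yes refl | _          = [] , xs , (λ ()) , refl
... | no x≢m   | here m≡x   = contradiction (sym m≡x) x≢m
... | no x≢m   | there m∈xs with first-occurrence m∈xs
...   | α , β , m∉α , refl = x ∷ α , β , (λ { (here m≡x) → x≢m (sym m≡x) ; (there m∈α) → m∉α m∈α }) , refl

split-at : ∀ {m w} → m ∈ w → w ≡ before m w ++ m ∷ after m w
split-at m∈ with first-occurrence m∈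
... | α , β , m∉α , refl = cong₂ (λ α′ β′ → α′ ++ _ ∷ β′) (sym (before-++ α β m∉α)) (sym (after-++ α β m∉α))

split-lengths : ∀ {w : List ℕ} α {m} β → w ≡ α ++ m ∷ β → length α < length w × length β < length w
split-lengths α {m} β refl =
  let |w|≡ = ≤-reflexive (sym (length-++ α {m ∷ β}))
  in ≤-trans (m<m+n (length α) (s≤s z≤n)) |w|≡ , ≤-trans (m≤n+m (suc (length β)) (length α)) |w|≡

Increasing-↭-unique : ∀ {xs ys} → Increasing xs → Increasing ys → xs ↭ ys → xs ≡ ys
Increasing-↭-unique xs↑ ys↑ xs↭ys = Pointwise-≡⇒≡
  (↗↭↗⇒≋ ≤-totalOrder (Linked.map <⇒≤ (AllPairs⇒Linked xs↑)) (Linked.map <⇒≤ (AllPairs⇒Linked ys↑)) (↭⇒↭ₛ xs↭ys))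

increasing-↭-head : ∀ {σ z ρ} → Increasing σ → σ ↭ z ∷ ρ → All (z <_) ρ →
                    ∃[ σ′ ] σ ≡ z ∷ σ′ × Increasing σ′ × All (z <_) σ′
increasing-↭-head {[]}     _            σ↭ _   = contradiction (↭.∈-resp-↭ (↭-sym σ↭) (here refl)) λ ()
increasing-↭-head {x ∷ σ′} (x<σ′ ∷ σ′↑) σ↭ z<ρ
  with ↭.∈-resp-↭ σ↭ (here refl) | ↭.∈-resp-↭ (↭-sym σ↭) (here refl)
... | here refl | _          = σ′ , refl , σ′↑ , x<σ′
... | there _   | here refl  = σ′ , refl , σ′↑ , x<σ′
... | there x∈ρ | there z∈σ′ = contradiction (All.lookup x<σ′ z∈σ′) (<⇒≯ (All.lookup z<ρ x∈ρ))

increasing-ends-at-max : ∀ {τ M} → Increasing τ → M ∈ τ → All (_≤ M) τ → ∃[ τ′ ] τ ≡ τ′ ++ M ∷ []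
increasing-ends-at-max τ↑ M∈ M-top with first-occurrence M∈
... | τ′ , []    , _ , refl = τ′ , refl
... | τ′ , _ ∷ _ , _ , refl with AllPairs-++⁻ τ′ τ↑
...   | _ , (M<y ∷ _) ∷ _ , _ = contradiction (All.lookup M-top (∈-++⁺ʳ τ′ (there (here refl)))) (<⇒≱ M<y)

-- Recursion on a word by splitting it at its ≼-greatest letter: stackSortF splits at the
-- maximum, lamF at the minimum.  View turns this recursion into an induction principle.

module PivotRecursion
  (_≼_ : ℕ → ℕ → Set)
  (≼-antisym : ∀ {x y} → x ≼ y → y ≼ x → x ≡ y)
  (pivot : ℕ → List ℕ → ℕ)
  (pivot-∈ : ∀ x xs → pivot x xs ∈ x ∷ xs)
  (pivot-top : ∀ x xs → All (_≼ pivot x xs) (x ∷ xs))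
  where

  pivot-unique : ∀ {x xs M} → M ∈ x ∷ xs → All (_≼ M) (x ∷ xs) → pivot x xs ≡ M
  pivot-unique M∈ M-top = ≼-antisym (All.lookup M-top (pivot-∈ _ _)) (All.lookup (pivot-top _ _) M∈)

  pivot-split-lengths : ∀ x xs → let p = pivot x xs; w = x ∷ xs in
                        length (before p w) ≤ length xs × length (after p w) ≤ length xs
  pivot-split-lengths x xs =
    let α< , β< = split-lengths _ _ (split-at (pivot-∈ x xs)) in s≤s⁻¹ α< , s≤s⁻¹ β<

  data View : List ℕ → Set where
    empty : View []
    split : ∀ {α M β} → M ∉ α → All (_≼ M) (α ++ M ∷ β) → View α → View β → View (α ++ M ∷ β)

  view : ∀ w → View w
  view w = viewF w ≤-refl
    where
    viewF : ∀ {k} w → length w ≤ k → View w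
    viewF []                 _       = empty
    viewF {suc k} (x ∷ xs) (s≤s l) with first-occurrence (pivot-∈ x xs)
    ... | α , β , p∉α , eq =
      let α< , β< = split-lengths α β eq
      in subst View (sym eq)
           (split p∉α (subst (All _) eq (pivot-top x xs))
                  (viewF α (≤-trans (s≤s⁻¹ α<) l)) (viewF β (≤-trans (s≤s⁻¹ β<) l)))

  module Recursion {X : Set} (base : X) (combine : List ℕ → ℕ → List ℕ → X → X → X) where

    recF : ℕ → List ℕ → X
    recF zero    _        = base
    recF (suc k) []       = base
    recF (suc k) (x ∷ xs) =
      let p = pivot x xs
          w = x ∷ xs
      in combine (before p w) p (after p w) (recF k (before p w)) (recF k (after p w))

    rec : List ℕ → X
    rec w = recF (length w) w

    recF-stable : ∀ {k k′} w → length w ≤ k → length w ≤ k′ → recF k w ≡ recF k′ w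
    recF-stable {zero}  {zero}   []       _       _        = refl
    recF-stable {zero}  {suc _}  []       _       _        = refl
    recF-stable {suc _} {zero}   []       _       _        = refl
    recF-stable {suc _} {suc _}  []       _       _        = refl
    recF-stable {suc k} {suc k′} (x ∷ xs) (s≤s l) (s≤s l′) =
      let p = pivot x xs
          w = x ∷ xs
          α≤ , β≤ = pivot-split-lengths x xs
      in cong₂ (combine (before p w) p (after p w))
               (recF-stable (before p w) (≤-trans α≤ l) (≤-trans α≤ l′))
               (recF-stable (after p w) (≤-trans β≤ l) (≤-trans β≤ l′))

    step : List ℕ → ℕ → List ℕ → X
    step α M β = combine α M β (rec α) (rec β)

    rec-∷ : ∀ x xs → let p = pivot x xs; w = x ∷ xs in rec w ≡ step (before p w) p (after p w)
    rec-∷ x xs =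
      let α≤ , β≤ = pivot-split-lengths x xs
      in cong₂ (combine _ _ _) (recF-stable _ α≤ ≤-refl) (recF-stable _ β≤ ≤-refl)

    private
      unfold-∷ : ∀ x xs {α M β} → x ∷ xs ≡ α ++ M ∷ β → M ∉ α → All (_≼ M) (x ∷ xs) →
                 rec (x ∷ xs) ≡ step α M β
      unfold-∷ x xs {α} {M} {β} eq M∉α M-top =
        let p≡M = pivot-unique (subst (M ∈_) (sym eq) (∈-++⁺ʳ α (here refl))) M-top
        in trans (rec-∷ x xs)
             (subst (λ p → step (before p (x ∷ xs)) p (after p (x ∷ xs)) ≡ step α M β) (sym p≡M)
               (cong₂ (λ α′ β′ → step α′ M β′)
                 (trans (cong (before M) eq) (before-++ α β M∉α))
                 (trans (cong (after M) eq) (after-++ α β M∉α))))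

    unfold : ∀ α {M} β → M ∉ α → All (_≼ M) (α ++ M ∷ β) → rec (α ++ M ∷ β) ≡ step α M β
    unfold []      β = unfold-∷ _ β refl
    unfold (a ∷ α) β = unfold-∷ a (α ++ _ ∷ β) refl

max-∈ : ∀ x xs → foldr _⊔_ x xs ∈ x ∷ xs
max-∈ x xs = [ (λ e → here e) , there ]′ (foldr-selective ⊔-sel x xs)

min-∈ : ∀ x xs → foldr _⊓_ x xs ∈ x ∷ xs
min-∈ x xs = [ (λ e → here e) , there ]′ (foldr-selective ⊓-sel x xs)

max-top : ∀ x xs → All (_≤ foldr _⊔_ x xs) (x ∷ xs)
max-top x []       = ≤-refl ∷ []
max-top x (y ∷ ys) with max-top x ys
... | x≤ ∷ ys≤ = ≤-trans x≤ (m≤n⊔m y _) ∷ m≤m⊔n y _ ∷ All.map (λ z≤ → ≤-trans z≤ (m≤n⊔m y _)) ys≤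

min-bottom : ∀ x xs → All (_≥ foldr _⊓_ x xs) (x ∷ xs)
min-bottom x []       = ≤-refl ∷ []
min-bottom x (y ∷ ys) with min-bottom x ys
... | ≤x ∷ ≤ys = ≤-trans (m⊓n≤n y _) ≤x ∷ m⊓n≤m y _ ∷ All.map (≤-trans (m⊓n≤n y _)) ≤ys

module Max = PivotRecursion _≤_ ≤-antisym (λ x xs → foldr _⊔_ x xs) max-∈ max-top
module Min = PivotRecursion _≥_ (λ x≥y y≥x → ≤-antisym y≥x x≥y) (λ x xs → foldr _⊓_ x xs) min-∈ min-bottom

-- Stack sorting

private
  module Sort = Max.Recursion [] (λ _ M _ sα sβ → sα ++ sβ ++ M ∷ [])
  module Output = Max.Recursion [] (λ α _ _ _ oβ → stackSort α ++ oβ)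
  module Residue = Max.Recursion [] (λ _ M _ _ rβ → rβ ++ M ∷ [])

stackSortF≡recF : ∀ k w → stackSortF k w ≡ Sort.recF k w
stackSortF≡recF zero    _        = refl
stackSortF≡recF (suc k) []       = refl
stackSortF≡recF (suc k) (x ∷ xs) =
  cong₂ (λ sα sβ → sα ++ sβ ++ _ ∷ []) (stackSortF≡recF k _) (stackSortF≡recF k _)

stackSort≡rec : ∀ w → stackSort w ≡ Sort.rec w
stackSort≡rec w = stackSortF≡recF (length w) w

stackSort-split : ∀ α {M} β → M ∉ α → All (_≤ M) (α ++ M ∷ β) →
                  stackSort (α ++ M ∷ β) ≡ stackSort α ++ stackSort β ++ M ∷ []
stackSort-split α {M} β M∉α M-top = begin
  stackSort (α ++ M ∷ β)             ≡⟨ stackSort≡rec (α ++ M ∷ β) ⟩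
  Sort.rec (α ++ M ∷ β)              ≡⟨ Sort.unfold α β M∉α M-top ⟩
  Sort.rec α ++ Sort.rec β ++ M ∷ [] ≡⟨ sym (cong₂ (λ sα sβ → sα ++ sβ ++ M ∷ []) (stackSort≡rec α) (stackSort≡rec β)) ⟩
  stackSort α ++ stackSort β ++ M ∷ [] ∎
  where open ≡-Reasoning

-- Stack sorting w pops stackOutput w while input remains, then empties the stack, which
-- holds stackResidue w (the right-to-left maxima of w, in increasing order).
stackOutput stackResidue : List ℕ → List ℕ
stackOutput  = Output.rec
stackResidue = Residue.rec

stackOutput-split : ∀ α {M} β → M ∉ α → All (_≤ M) (α ++ M ∷ β) →
                    stackOutput (α ++ M ∷ β) ≡ stackSort α ++ stackOutput β
stackOutput-split = Output.unfold

stackResidue-split : ∀ α {M} β → M ∉ α → All (_≤ M) (α ++ M ∷ β) →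
                     stackResidue (α ++ M ∷ β) ≡ stackResidue β ++ M ∷ []
stackResidue-split = Residue.unfold

stackSort↭ : ∀ w → stackSort w ↭ w
stackSort↭ w = go (Max.view w)
  where
  open PermutationReasoning
  go : ∀ {w} → Max.View w → stackSort w ↭ w
  go Max.empty                                 = ↭-refl
  go (Max.split {α} {M} {β} M∉α M-top vα vβ) = begin
    stackSort (α ++ M ∷ β)               ≡⟨ stackSort-split α β M∉α M-top ⟩
    stackSort α ++ stackSort β ++ M ∷ [] ↭⟨ ↭.++⁺ (go vα) (↭.++⁺ʳ (M ∷ []) (go vβ)) ⟩
    α ++ β ++ M ∷ []                     ↭⟨ ↭.++⁺ˡ α (↭-sym (∷↭∷ʳ M β)) ⟩
    α ++ M ∷ β                           ∎

stackSort-∷ : ∀ {a} w → All (a <_) w → stackSort (a ∷ w) ≡ a ∷ stackSort w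
stackSort-∷ w = go (Max.view w)
  where
  go : ∀ {a w} → Max.View w → All (a <_) w → stackSort (a ∷ w) ≡ a ∷ stackSort w
  go Max.empty                                 _   = refl
  go {a} (Max.split {α} {M} {β} M∉α M-top vα _) a<w =
    let a<M = All.lookup a<w (∈-++⁺ʳ α (here refl))
    in begin
      stackSort ((a ∷ α) ++ M ∷ β)                 ≡⟨ stackSort-split (a ∷ α) β (∉-∷ a<M M∉α) (<⇒≤ a<M ∷ M-top) ⟩
      stackSort (a ∷ α) ++ stackSort β ++ M ∷ []   ≡⟨ cong (_++ _) (go vα (All.++⁻ˡ α a<w)) ⟩
      a ∷ (stackSort α ++ stackSort β ++ M ∷ [])   ≡⟨ cong (a ∷_) (sym (stackSort-split α β M∉α M-top)) ⟩
      a ∷ stackSort (α ++ M ∷ β)                   ∎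
    where open ≡-Reasoning

stackResidue-⊆ : ∀ w → stackResidue w ⊆ w
stackResidue-⊆ w = go (Max.view w)
  where
  go : ∀ {w} → Max.View w → stackResidue w ⊆ w
  go (Max.split {α} {M} {β} M∉α M-top _ vβ) x∈
    rewrite stackResidue-split α β M∉α M-top with ∈-++⁻ (stackResidue β) x∈
  ... | inj₁ x∈β           = ∈-++⁺ʳ α (there (go vβ x∈β))
  ... | inj₂ (here refl) = ∈-++⁺ʳ α (here refl)

private
  max-++ : ∀ α {M} β {γ} → All (_≤ M) (α ++ M ∷ β) → All (_< M) γ → All (_≤ M) (α ++ M ∷ (β ++ γ))
  max-++ α β {γ} M-top γ<M = subst (All _) (++-assoc α (_ ∷ β) γ) (All.++⁺ M-top (All.map <⇒≤ γ<M))

  ≪-tail : ∀ {γ} α {M} β → γ ≪ α ++ M ∷ β → γ ≪ β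
  ≪-tail α β = All.map (All.tail ∘ All.++⁻ʳ α)

stackOutput-++ : ∀ α {γ} → γ ≪ α → stackOutput (α ++ γ) ≡ stackOutput α ++ stackOutput γ
stackOutput-++ α = go (Max.view α)
  where
  open ≡-Reasoning
  go : ∀ {α} → Max.View α → ∀ {γ} → γ ≪ α → stackOutput (α ++ γ) ≡ stackOutput α ++ stackOutput γ
  go Max.empty                                _  = refl
  go (Max.split {α} {M} {β} M∉α M-top _ vβ) {γ} γ≪ = begin
    stackOutput ((α ++ M ∷ β) ++ γ)                 ≡⟨ cong stackOutput (++-assoc α (M ∷ β) γ) ⟩
    stackOutput (α ++ M ∷ (β ++ γ))                 ≡⟨ stackOutput-split α (β ++ γ) M∉α (max-++ α β M-top γ<M) ⟩
    stackSort α ++ stackOutput (β ++ γ)             ≡⟨ cong (stackSort α ++_) (go vβ (≪-tail α β γ≪)) ⟩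
    stackSort α ++ stackOutput β ++ stackOutput γ   ≡⟨ sym (++-assoc (stackSort α) _ _) ⟩
    (stackSort α ++ stackOutput β) ++ stackOutput γ ≡⟨ cong (_++ _) (sym (stackOutput-split α β M∉α M-top)) ⟩
    stackOutput (α ++ M ∷ β) ++ stackOutput γ       ∎
    where γ<M = ≪-lookup γ≪ (∈-++⁺ʳ α (here refl))

stackResidue-++ : ∀ α {γ} → γ ≪ α → stackResidue (α ++ γ) ≡ stackResidue γ ++ stackResidue α
stackResidue-++ α = go (Max.view α)
  where
  open ≡-Reasoning
  go : ∀ {α} → Max.View α → ∀ {γ} → γ ≪ α → stackResidue (α ++ γ) ≡ stackResidue γ ++ stackResidue α
  go Max.empty                                {γ} _  = sym (++-identityʳ (stackResidue γ))
  go (Max.split {α} {M} {β} M∉α M-top _ vβ) {γ} γ≪ = begin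
    stackResidue ((α ++ M ∷ β) ++ γ)                   ≡⟨ cong stackResidue (++-assoc α (M ∷ β) γ) ⟩
    stackResidue (α ++ M ∷ (β ++ γ))                   ≡⟨ stackResidue-split α (β ++ γ) M∉α (max-++ α β M-top γ<M) ⟩
    stackResidue (β ++ γ) ++ M ∷ []                    ≡⟨ cong (_++ M ∷ []) (go vβ (≪-tail α β γ≪)) ⟩
    (stackResidue γ ++ stackResidue β) ++ M ∷ []       ≡⟨ ++-assoc (stackResidue γ) _ _ ⟩
    stackResidue γ ++ stackResidue β ++ M ∷ []         ≡⟨ cong (stackResidue γ ++_) (sym (stackResidue-split α β M∉α M-top)) ⟩
    stackResidue γ ++ stackResidue (α ++ M ∷ β)        ∎
    where γ<M = ≪-lookup γ≪ (∈-++⁺ʳ α (here refl))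

stackOutput-∷ : ∀ {a} w → w ≢ [] → All (a <_) w → stackOutput (a ∷ w) ≡ a ∷ stackOutput w
stackOutput-∷ {a} w w≢[] a<w with Max.view w
... | Max.empty = contradiction refl w≢[]
... | Max.split {α} {M} {β} M∉α M-top _ _ =
  let a<M = All.lookup a<w (∈-++⁺ʳ α (here refl))
  in begin
    stackOutput ((a ∷ α) ++ M ∷ β)        ≡⟨ stackOutput-split (a ∷ α) β (∉-∷ a<M M∉α) (<⇒≤ a<M ∷ M-top) ⟩
    stackSort (a ∷ α) ++ stackOutput β    ≡⟨ cong (_++ _) (stackSort-∷ α (All.++⁻ˡ α a<w)) ⟩
    a ∷ (stackSort α ++ stackOutput β)    ≡⟨ cong (a ∷_) (sym (stackOutput-split α β M∉α M-top)) ⟩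
    a ∷ stackOutput (α ++ M ∷ β)          ∎
  where open ≡-Reasoning

stackResidue-∷ : ∀ {a} w → w ≢ [] → All (a <_) w → stackResidue (a ∷ w) ≡ stackResidue w
stackResidue-∷ {a} w w≢[] a<w with Max.view w
... | Max.empty = contradiction refl w≢[]
... | Max.split {α} {M} {β} M∉α M-top _ _ =
  let a<M = All.lookup a<w (∈-++⁺ʳ α (here refl))
  in trans (stackResidue-split (a ∷ α) β (∉-∷ a<M M∉α) (<⇒≤ a<M ∷ M-top))
           (sym (stackResidue-split α β M∉α M-top))

private
  residue-++-below : ∀ {σ M} P τ → σ ↭ stackResidue P ++ τ → All (_< M) (P ++ τ) → All (_< M) σ
  residue-++-below P τ σ↭ <M =
    All-resp-↭ (↭-sym σ↭) (All.++⁺ (All.anti-mono (stackResidue-⊆ P) (All.++⁻ˡ P <M)) (All.++⁻ʳ P <M))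

  ↭-snoc-middle : ∀ {σ} ρ {M : ℕ} τ → σ ↭ ρ ++ τ → σ ++ M ∷ [] ↭ (ρ ++ M ∷ []) ++ τ
  ↭-snoc-middle {σ} ρ {M} τ σ↭ = begin
    σ ++ M ∷ []               ↭⟨ ↭.++⁺ʳ (M ∷ []) σ↭ ⟩
    (ρ ++ τ) ++ M ∷ []        ≡⟨ ++-assoc ρ τ _ ⟩
    ρ ++ τ ++ M ∷ []          ↭⟨ ↭.++⁺ˡ ρ (↭-sym (∷↭∷ʳ M τ)) ⟩
    ρ ++ M ∷ τ                ≡⟨ sym (++-assoc ρ (M ∷ []) τ) ⟩
    (ρ ++ M ∷ []) ++ τ        ∎
    where open PermutationReasoning

TailMerge : List ℕ → List ℕ → Set
TailMerge P τ = ∃[ σ ] stackSort (P ++ τ) ≡ stackOutput P ++ σ × Increasing σ × σ ↭ stackResidue P ++ τ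

TailMerge-snoc : ∀ P τ {M} → M ∉ P ++ τ → All (_≤ M) ((P ++ τ) ++ M ∷ []) →
                 TailMerge P τ → TailMerge P (τ ++ M ∷ [])
TailMerge-snoc P τ {M} M∉ M-top (σ , sorts , σ↑ , σ↭) =
  σ ++ M ∷ [] ,
  (begin
     stackSort (P ++ τ ++ M ∷ [])     ≡⟨ cong stackSort (sym (++-assoc P τ (M ∷ []))) ⟩
     stackSort ((P ++ τ) ++ M ∷ [])   ≡⟨ stackSort-split (P ++ τ) [] M∉ M-top ⟩
     stackSort (P ++ τ) ++ M ∷ []     ≡⟨ cong (_++ M ∷ []) sorts ⟩
     (stackOutput P ++ σ) ++ M ∷ []   ≡⟨ ++-assoc (stackOutput P) σ (M ∷ []) ⟩
     stackOutput P ++ σ ++ M ∷ []     ∎) ,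
  snoc-increasing σ↑ (residue-++-below P τ σ↭ (below-max (All.++⁻ˡ (P ++ τ) M-top) M∉)) ,
  ↭-trans (↭.++⁺ʳ (M ∷ []) σ↭) (↭-reflexive (++-assoc (stackResidue P) τ (M ∷ [])))
  where open ≡-Reasoning

TailMerge-split : ∀ P₁ {M} P₂ τ → M ∉ P₁ → M ∉ P₂ ++ τ → All (_≤ M) (P₁ ++ M ∷ (P₂ ++ τ)) →
                  TailMerge P₂ τ → TailMerge (P₁ ++ M ∷ P₂) τ
TailMerge-split P₁ {M} P₂ τ M∉P₁ M∉ M-top (σ , sorts , σ↑ , σ↭) =
  σ ++ M ∷ [] ,
  (begin
     stackSort ((P₁ ++ M ∷ P₂) ++ τ)                  ≡⟨ cong stackSort (++-assoc P₁ (M ∷ P₂) τ) ⟩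
     stackSort (P₁ ++ M ∷ (P₂ ++ τ))                  ≡⟨ stackSort-split P₁ (P₂ ++ τ) M∉P₁ M-top ⟩
     stackSort P₁ ++ stackSort (P₂ ++ τ) ++ M ∷ []    ≡⟨ cong (λ s → stackSort P₁ ++ s ++ M ∷ []) sorts ⟩
     stackSort P₁ ++ (stackOutput P₂ ++ σ) ++ M ∷ []  ≡⟨ cong (stackSort P₁ ++_) (++-assoc (stackOutput P₂) σ _) ⟩
     stackSort P₁ ++ stackOutput P₂ ++ σ ++ M ∷ []    ≡⟨ sym (++-assoc (stackSort P₁) _ _) ⟩
     (stackSort P₁ ++ stackOutput P₂) ++ σ ++ M ∷ []  ≡⟨ cong (_++ σ ++ M ∷ []) (sym (stackOutput-split P₁ P₂ M∉P₁ M-topP)) ⟩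
     stackOutput (P₁ ++ M ∷ P₂) ++ σ ++ M ∷ []        ∎) ,
  snoc-increasing σ↑ (residue-++-below P₂ τ σ↭ (below-max (All.tail (All.++⁻ʳ P₁ M-top)) M∉)) ,
  subst (λ ρ → σ ++ M ∷ [] ↭ ρ ++ τ) (sym (stackResidue-split P₁ P₂ M∉P₁ M-topP))
        (↭-snoc-middle (stackResidue P₂) τ σ↭)
  where
  open ≡-Reasoning
  M-topP : All (_≤ M) (P₁ ++ M ∷ P₂)
  M-topP = All.++⁻ˡ (P₁ ++ M ∷ P₂) (subst (All _) (sym (++-assoc P₁ (M ∷ P₂) τ)) M-top)

-- The maximum of P ++ τ is either the last letter of τ or a letter of P.
stackSort-++-increasing : ∀ P τ → Unique (P ++ τ) → Increasing τ → TailMerge P τ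
stackSort-++-increasing P τ = go (Max.view (P ++ τ)) P τ refl
  where
  go : ∀ {w} → Max.View w → ∀ P τ → w ≡ P ++ τ → Unique w → Increasing τ → TailMerge P τ
  go Max.empty [] [] refl _ _ = [] , refl , [] , ↭-refl
  go (Max.split {α} {M} {β} M∉α M-top vα vβ) P τ eq u τ↑
    with ∈-++⁻ P (subst (M ∈_) eq (∈-++⁺ʳ α (here refl)))
  ... | inj₂ M∈τ with increasing-ends-at-max τ↑ M∈τ (All.++⁻ʳ P (subst (All _) eq M-top))
  ...   | τ′ , refl
          with split-unique α (P ++ τ′) M∉α
                 (Unique-∉ (P ++ τ′) (subst Unique (trans eq (sym (++-assoc P τ′ (M ∷ [])))) u))
                 (trans eq (sym (++-assoc P τ′ (M ∷ []))))
  ...     | refl , refl =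
    TailMerge-snoc P τ′ M∉α M-top (go vα P τ′ refl (proj₁ (AllPairs-++⁻ (P ++ τ′) u)) (proj₁ (AllPairs-++⁻ τ′ τ↑)))
  go (Max.split {α} {M} {β} M∉α M-top vα vβ) P τ eq u τ↑
      | inj₁ M∈P with first-occurrence M∈P
  ... | P₁ , P₂ , M∉P₁ , refl with split-unique α P₁ M∉α M∉P₁ (trans eq (++-assoc P₁ (M ∷ P₂) τ))
  ...   | refl , refl =
    let M∷β↑ = proj₁ (proj₂ (AllPairs-++⁻ P₁ u))
    in TailMerge-split P₁ P₂ τ M∉α (All¬⇒¬Any (AllPairs.head M∷β↑)) M-top (go vβ P₂ τ refl (AllPairs.tail M∷β↑) τ↑)

-- Trees

inorder : Tree → List ℕ
inorder leaf         = []
inorder (node l a r) = inorder l ++ a ∷ inorder r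

arm : Tree → List ℕ
arm leaf         = []
arm (node _ a r) = a ∷ arm r

lastArm : Tree → ℕ
lastArm leaf                     = 0
lastArm (node _ a leaf)          = a
lastArm (node _ _ r@(node _ _ _)) = lastArm r

-- The trees λ(π) of 213-avoiding permutations π.
data Layered : Tree → Set where
  leaf : Layered leaf
  node : ∀ {l a r} → All (a <_) (inorder l) → All (a <_) (inorder r) → inorder r ≪ inorder l →
         Layered l → Layered r → Layered (node l a r)

data RightComb : Tree → Set where
  leaf : RightComb leaf
  node : ∀ {a r} → RightComb r → RightComb (node leaf a r)

prune : Tree → Tree
prune leaf                       = leaf
prune (node l a leaf)            = prune l
prune (node l a r@(node _ _ _)) = node (prune l) a (prune r)

pruneOffArm : Tree → Tree
pruneOffArm leaf         = leaf
pruneOffArm (node l a r) = node (prune l) a (pruneOffArm r)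

inorder-≢[] : ∀ l a r → inorder (node l a r) ≢ []
inorder-≢[] l a r eq with inorder l
inorder-≢[] l a r () | []
inorder-≢[] l a r () | _ ∷ _

arm-pruneOffArm : ∀ T → arm (pruneOffArm T) ≡ arm T
arm-pruneOffArm leaf         = refl
arm-pruneOffArm (node _ a r) = cong (a ∷_) (arm-pruneOffArm r)

lastArm-∈ : ∀ l a r → lastArm (node l a r) ∈ arm (node l a r)
lastArm-∈ l a leaf           = here refl
lastArm-∈ l a (node l′ b r′) = there (lastArm-∈ l′ b r′)

arm-⊆-inorder : ∀ T → arm T ⊆ inorder T
arm-⊆-inorder leaf         = ⊆.⊆-refl
arm-⊆-inorder (node l a r) = ⊆.⊆-trans (⊆.∷⁺ʳ a (arm-⊆-inorder r)) (xs⊆ys++xs _ (inorder l))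

arm-≤-lastArm : ∀ {l a r} → Layered (node l a r) → All (_≤ lastArm (node l a r)) (arm (node l a r))
arm-≤-lastArm {r = leaf}         _                   = ≤-refl ∷ []
arm-≤-lastArm {r = node l′ b r′} (node _ a<r _ _ lay-r) =
  let ≤z = arm-≤-lastArm lay-r
  in <⇒≤ (<-≤-trans (All.lookup a<r (arm-⊆-inorder (node l′ b r′) (here refl))) (All.head ≤z)) ∷ ≤z

inorder-prune-⊆ : ∀ T → inorder (prune T) ⊆ inorder T
inorder-prune-⊆ leaf                      = ⊆.⊆-refl
inorder-prune-⊆ (node l a leaf)           = ⊆.⊆-trans (inorder-prune-⊆ l) (xs⊆xs++ys _ _)
inorder-prune-⊆ (node l a r@(node _ _ _)) = ⊆.++⁺ (inorder-prune-⊆ l) (⊆.∷⁺ʳ a (inorder-prune-⊆ r))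

inorder-pruneOffArm-⊆ : ∀ T → inorder (pruneOffArm T) ⊆ inorder T
inorder-pruneOffArm-⊆ leaf         = ⊆.⊆-refl
inorder-pruneOffArm-⊆ (node l a r) = ⊆.++⁺ (inorder-prune-⊆ l) (⊆.∷⁺ʳ a (inorder-pruneOffArm-⊆ r))

Layered-shrink : ∀ {l a r l′ r′} → inorder l′ ⊆ inorder l → inorder r′ ⊆ inorder r →
                 Layered (node l a r) → Layered l′ → Layered r′ → Layered (node l′ a r′)
Layered-shrink l′⊆l r′⊆r (node a<l a<r r≪l _ _) =
  node (All.anti-mono l′⊆l a<l) (All.anti-mono r′⊆r a<r) (All.anti-mono r′⊆r (All.map (All.anti-mono l′⊆l) r≪l))

Layered-prune : ∀ {T} → Layered T → Layered (prune T)
Layered-prune {leaf}                    leaf                 = leaf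
Layered-prune {node l a leaf}           (node _ _ _ lay-l _) = Layered-prune lay-l
Layered-prune {node l a r@(node _ _ _)} lay@(node _ _ _ lay-l lay-r) =
  Layered-shrink (inorder-prune-⊆ l) (inorder-prune-⊆ r) lay (Layered-prune lay-l) (Layered-prune lay-r)

Layered-pruneOffArm : ∀ {T} → Layered T → Layered (pruneOffArm T)
Layered-pruneOffArm leaf                              = leaf
Layered-pruneOffArm {node l a r} lay@(node _ _ _ lay-l lay-r) =
  Layered-shrink (inorder-prune-⊆ l) (inorder-pruneOffArm-⊆ r) lay (Layered-prune lay-l) (Layered-pruneOffArm lay-r)

stackOutput-singleton : ∀ a → stackOutput (a ∷ []) ≡ []
stackOutput-singleton a = stackOutput-split [] {a} [] (λ ()) (≤-refl ∷ [])

stackResidue-singleton : ∀ a → stackResidue (a ∷ []) ≡ a ∷ []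
stackResidue-singleton a = stackResidue-split [] {a} [] (λ ()) (≤-refl ∷ [])

stackOutput-inorder : ∀ {T} → Layered T → stackOutput (inorder T) ≡ inorder (prune T)
stackOutput-inorder {leaf}                    leaf = refl
stackOutput-inorder {node l a leaf}           (node a<l _ r≪l lay-l _) = begin
  stackOutput (inorder l ++ a ∷ [])                 ≡⟨ stackOutput-++ (inorder l) (a<l ∷ r≪l) ⟩
  stackOutput (inorder l) ++ stackOutput (a ∷ [])   ≡⟨ cong₂ _++_ (stackOutput-inorder lay-l) (stackOutput-singleton a) ⟩
  inorder (prune l) ++ []                           ≡⟨ ++-identityʳ _ ⟩
  inorder (prune l)                                 ∎
  where open ≡-Reasoning
stackOutput-inorder {node l a r@(node l′ b r′)} (node a<l a<r r≪l lay-l lay-r) = begin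
  stackOutput (inorder l ++ a ∷ inorder r)               ≡⟨ stackOutput-++ (inorder l) (a<l ∷ r≪l) ⟩
  stackOutput (inorder l) ++ stackOutput (a ∷ inorder r) ≡⟨ cong (stackOutput (inorder l) ++_) (stackOutput-∷ (inorder r) (inorder-≢[] l′ b r′) a<r) ⟩
  stackOutput (inorder l) ++ a ∷ stackOutput (inorder r) ≡⟨ cong₂ (λ o o′ → o ++ a ∷ o′) (stackOutput-inorder lay-l) (stackOutput-inorder lay-r) ⟩
  inorder (prune l) ++ a ∷ inorder (prune r)             ∎
  where open ≡-Reasoning

stackResidue-inorder : ∀ {l a r} → Layered (node l a r) → let z = lastArm (node l a r) in
                       ∃[ B ] stackResidue (inorder (node l a r)) ≡ z ∷ B × All (z <_) B
stackResidue-inorder {l} {a} {leaf} (node a<l _ r≪l _ _) =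
  stackResidue (inorder l) ,
  trans (stackResidue-++ (inorder l) (a<l ∷ r≪l)) (cong (_++ stackResidue (inorder l)) (stackResidue-singleton a)) ,
  All.anti-mono (stackResidue-⊆ (inorder l)) a<l
stackResidue-inorder {l} {a} {r@(node l′ b r′)} (node a<l a<r r≪l _ lay-r) =
  let B′ , eq , z<B′ = stackResidue-inorder lay-r
      z<l = All.lookup r≪l (arm-⊆-inorder r (lastArm-∈ l′ b r′))
  in B′ ++ stackResidue (inorder l) ,
     trans (stackResidue-++ (inorder l) (a<l ∷ r≪l))
       (cong (_++ stackResidue (inorder l)) (trans (stackResidue-∷ (inorder r) (inorder-≢[] l′ b r′) a<r) eq)) ,
     All.++⁺ z<B′ (All.anti-mono (stackResidue-⊆ (inorder l)) z<l)

inorder-prune-++-lastArm : ∀ l a r → inorder (prune (node l a r)) ++ lastArm (node l a r) ∷ [] ≡ inorder (pruneOffArm (node l a r))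
inorder-prune-++-lastArm l a leaf           = refl
inorder-prune-++-lastArm l a (node l′ b r′) =
  trans (++-assoc (inorder (prune l)) (a ∷ _) _) (cong (λ w → inorder (prune l) ++ a ∷ w) (inorder-prune-++-lastArm l′ b r′))

ArmTail : Tree → List ℕ → Set
ArmTail T τ = Increasing τ × arm T ≪ τ

-- The output of the in-order word is inorder (prune T); the smallest letter of the
-- merged tail is lastArm T, which completes inorder (pruneOffArm T).
stackSort-inorder-++ : ∀ {T τ} → Layered T → ArmTail T τ → Unique (inorder T ++ τ) →
                       ∃[ τ′ ] stackSort (inorder T ++ τ) ≡ inorder (pruneOffArm T) ++ τ′ × ArmTail (pruneOffArm T) τ′
stackSort-inorder-++ {leaf} {τ} _ (τ↑ , _) u =
  let σ , sorts , σ↑ , σ↭ = stackSort-++-increasing [] τ u τ↑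
  in τ , trans sorts (Increasing-↭-unique σ↑ τ↑ σ↭) , τ↑ , []
stackSort-inorder-++ {node l a r} {τ} lay (τ↑ , arm≪τ) u =
  let T = node l a r
      z = lastArm T
      σ , sorts , σ↑ , σ↭ = stackSort-++-increasing (inorder T) τ u τ↑
      B , residue≡ , z<B = stackResidue-inorder lay
      z<τ = All.lookup arm≪τ (lastArm-∈ l a r)
      τ′ , σ≡ , τ′↑ , z<τ′ = increasing-↭-head σ↑ (subst (λ ρ → σ ↭ ρ ++ τ) residue≡ σ↭) (All.++⁺ z<B z<τ)
  in τ′ ,
     (begin
        stackSort (inorder T ++ τ)              ≡⟨ sorts ⟩
        stackOutput (inorder T) ++ σ            ≡⟨ cong₂ _++_ (stackOutput-inorder lay) σ≡ ⟩
        inorder (prune T) ++ z ∷ τ′             ≡⟨ sym (++-assoc (inorder (prune T)) (z ∷ []) τ′) ⟩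
        (inorder (prune T) ++ z ∷ []) ++ τ′     ≡⟨ cong (_++ τ′) (inorder-prune-++-lastArm l a r) ⟩
        inorder (pruneOffArm T) ++ τ′           ∎) ,
     τ′↑ ,
     subst (_≪ τ′) (sym (arm-pruneOffArm T))
       (All.map (λ x≤z → All.map (≤-<-trans x≤z) z<τ′) (arm-≤-lastArm lay))
  where open ≡-Reasoning

stackSortIter-inorder-++ : ∀ t {T τ} → Layered T → ArmTail T τ → Unique (inorder T ++ τ) →
  ∃[ τ′ ] stackSortIter t (inorder T ++ τ) ≡ inorder (iterate pruneOffArm T t) ++ τ′ × ArmTail (iterate pruneOffArm T t) τ′
stackSortIter-inorder-++ zero    {T} {τ} _   tail _ = τ , refl , tail
stackSortIter-inorder-++ (suc t) {T} {τ} lay tail u =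
  let τ₁ , sorts , tail₁ = stackSort-inorder-++ lay tail u
      u₁ = subst Unique sorts (Unique-resp-↭ (↭⇒↭ₛ (↭-sym (stackSort↭ (inorder T ++ τ)))) u)
      τ′ , iter , tail′ = stackSortIter-inorder-++ t (Layered-pruneOffArm lay) tail₁ u₁
  in τ′ , trans (cong (stackSortIter t) sorts) iter , tail′

Layered-iterate : ∀ t {T} → Layered T → Layered (iterate pruneOffArm T t)
Layered-iterate zero    lay = lay
Layered-iterate (suc t) lay = Layered-iterate t (Layered-pruneOffArm lay)

RightComb⇒inorder≡arm : ∀ {T} → RightComb T → inorder T ≡ arm T
RightComb⇒inorder≡arm leaf           = refl
RightComb⇒inorder≡arm (node {a} comb) = cong (a ∷_) (RightComb⇒inorder≡arm comb)

RightComb⇒increasing : ∀ {T} → Layered T → RightComb T → Increasing (inorder T)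
RightComb⇒increasing leaf                    leaf        = []
RightComb⇒increasing (node _ a<r _ _ lay-r) (node comb) = a<r ∷ RightComb⇒increasing lay-r comb

increasing⇒RightComb : ∀ {T} → Layered T → Increasing (inorder T) → RightComb T
increasing⇒RightComb {leaf}                leaf                    _          = leaf
increasing⇒RightComb {node leaf a r}       (node _ _ _ _ lay-r)    (_ ∷ r↑)   = node (increasing⇒RightComb lay-r r↑)
increasing⇒RightComb {node (node l b r) a _} (node a<l _ _ _ _) ↑ =
  let b∈ = ∈-++⁺ʳ (inorder l) (here refl)
      _ , _ , l<a = AllPairs-++⁻ (inorder (node l b r)) ↑
  in contradiction (All.lookup a<l b∈) (<⇒≯ (All.head (All.lookup l<a b∈)))

increasing-inorder-++⇔RightComb : ∀ {T τ} → Layered T → ArmTail T τ → Increasing (inorder T ++ τ) ⇔ RightComb T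
increasing-inorder-++⇔RightComb {T} {τ} lay (τ↑ , arm≪τ) = mk⇔
  (λ ↑ → increasing⇒RightComb lay (proj₁ (AllPairs-++⁻ (inorder T) ↑)))
  (λ comb → AllPairsₚ.++⁺ (RightComb⇒increasing lay comb) τ↑
              (subst (_≪ τ) (sym (RightComb⇒inorder≡arm comb)) arm≪τ))

sortable⇔RightComb : ∀ t {T} → Layered T → Unique (inorder T) →
                     Increasing (stackSortIter t (inorder T)) ⇔ RightComb (iterate pruneOffArm T t)
sortable⇔RightComb t {T} lay u =
  let τ′ , iter , tail′ = stackSortIter-inorder-++ t lay ([] , All.tabulate (λ _ → []))
                            (subst Unique (sym (++-identityʳ (inorder T))) u)
  in begin
    Increasing (stackSortIter t (inorder T))                      ≡⟨ cong (Increasing ∘ stackSortIter t) (sym (++-identityʳ (inorder T))) ⟩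
    Increasing (stackSortIter t (inorder T ++ []))                ≡⟨ cong Increasing iter ⟩
    Increasing (inorder (iterate pruneOffArm T t) ++ τ′)          ≈⟨ increasing-inorder-++⇔RightComb (Layered-iterate t lay) tail′ ⟩
    RightComb (iterate pruneOffArm T t)                           ∎
  where open SetoidReasoning (⇔-setoid 0ℓ)

-- Right depth

mutual
  rightDepth : Tree → ℕ
  rightDepth leaf         = 0
  rightDepth (node l _ r) = rightDepth l ⊔ rightDepthᴿ r

  rightDepthᴿ : Tree → ℕ
  rightDepthᴿ leaf             = 0
  rightDepthᴿ T@(node _ _ _) = suc (rightDepth T)

offArmDepth : Tree → ℕ
offArmDepth leaf         = 0
offArmDepth (node l _ r) = rightDepth l ⊔ offArmDepth r

private
  pred-⊔-suc : ∀ m n → (m ∸ 1) ⊔ n ≡ (m ⊔ suc n) ∸ 1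
  pred-⊔-suc zero    n = refl
  pred-⊔-suc (suc m) n = refl

  suc-pred-⊔ : ∀ m n → suc ((m ∸ 1) ⊔ n) ≡ m ⊔ suc n
  suc-pred-⊔ zero    n = refl
  suc-pred-⊔ (suc m) n = refl

mutual
  rightDepth-prune : ∀ T → rightDepth (prune T) ≡ rightDepth T ∸ 1
  rightDepth-prune leaf                        = refl
  rightDepth-prune (node l a leaf)             = trans (rightDepth-prune l) (cong (_∸ 1) (sym (⊔-identityʳ (rightDepth l))))
  rightDepth-prune (node l a r@(node _ _ _)) =
    trans (cong₂ _⊔_ (rightDepth-prune l) (rightDepthᴿ-prune r)) (pred-⊔-suc (rightDepth l) (rightDepth r))

  -- pruning removes exactly the last right edge of every path
  rightDepthᴿ-prune : ∀ T → rightDepthᴿ (prune T) ≡ rightDepth T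
  rightDepthᴿ-prune leaf                        = refl
  rightDepthᴿ-prune (node l a leaf)             = trans (rightDepthᴿ-prune l) (sym (⊔-identityʳ (rightDepth l)))
  rightDepthᴿ-prune (node l a r@(node _ _ _)) =
    trans (cong suc (cong₂ _⊔_ (rightDepth-prune l) (rightDepthᴿ-prune r))) (suc-pred-⊔ (rightDepth l) (rightDepth r))

prune≡leaf⇔rightDepth≡0 : ∀ T → prune T ≡ leaf ⇔ rightDepth T ≡ 0
prune≡leaf⇔rightDepth≡0 T = mk⇔
  (λ prune≡leaf → trans (sym (rightDepthᴿ-prune T)) (cong rightDepthᴿ prune≡leaf))
  (λ depth≡0 → rightDepthᴿ≡0 (prune T) (trans (rightDepthᴿ-prune T) depth≡0))
  where
  rightDepthᴿ≡0 : ∀ T → rightDepthᴿ T ≡ 0 → T ≡ leaf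
  rightDepthᴿ≡0 leaf _ = refl

iterate-suc : ∀ {A : Set} (f : A → A) x t → iterate f x (suc t) ≡ f (iterate f x t)
iterate-suc f x zero    = refl
iterate-suc f x (suc t) = iterate-suc f (f x) t

rightDepth-iterate-prune : ∀ t T → rightDepth (iterate prune T t) ≡ rightDepth T ∸ t
rightDepth-iterate-prune zero    T = refl
rightDepth-iterate-prune (suc t) T =
  trans (rightDepth-iterate-prune t (prune T))
        (trans (cong (_∸ t) (rightDepth-prune T)) (∸-+-assoc (rightDepth T) 1 t))

iterate-prune≡leaf⇔ : ∀ t T → iterate prune T (suc t) ≡ leaf ⇔ rightDepth T ≤ t
iterate-prune≡leaf⇔ t T = begin
  iterate prune T (suc t) ≡ leaf            ≡⟨ cong (_≡ leaf) (iterate-suc prune T t) ⟩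
  prune (iterate prune T t) ≡ leaf          ≈⟨ prune≡leaf⇔rightDepth≡0 (iterate prune T t) ⟩
  rightDepth (iterate prune T t) ≡ 0        ≡⟨ cong (_≡ 0) (rightDepth-iterate-prune t T) ⟩
  rightDepth T ∸ t ≡ 0                      ≈⟨ mk⇔ m∸n≡0⇒m≤n m≤n⇒m∸n≡0 ⟩
  rightDepth T ≤ t                          ∎
  where open SetoidReasoning (⇔-setoid 0ℓ)

iterate-pruneOffArm-leaf : ∀ t → iterate pruneOffArm leaf t ≡ leaf
iterate-pruneOffArm-leaf zero    = refl
iterate-pruneOffArm-leaf (suc t) = iterate-pruneOffArm-leaf t

iterate-pruneOffArm-node : ∀ t l a r →
  iterate pruneOffArm (node l a r) t ≡ node (iterate prune l t) a (iterate pruneOffArm r t)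
iterate-pruneOffArm-node zero    l a r = refl
iterate-pruneOffArm-node (suc t) l a r = iterate-pruneOffArm-node t (prune l) a (pruneOffArm r)

RightComb-node⇔ : ∀ l a r → RightComb (node l a r) ⇔ (l ≡ leaf × RightComb r)
RightComb-node⇔ l a r = mk⇔ (λ { (node comb) → refl , comb }) (λ { (refl , comb) → node comb })

RightComb-iterate⇔ : ∀ t T → RightComb (iterate pruneOffArm T (suc t)) ⇔ offArmDepth T ≤ t
RightComb-iterate⇔ t leaf rewrite iterate-pruneOffArm-leaf (suc t) = mk⇔ (λ _ → z≤n) (λ _ → leaf)
RightComb-iterate⇔ t (node l a r) = begin
  RightComb (iterate pruneOffArm (node l a r) (suc t))                            ≡⟨ cong RightComb (iterate-pruneOffArm-node (suc t) l a r) ⟩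
  RightComb (node (iterate prune l (suc t)) a (iterate pruneOffArm r (suc t)))    ≈⟨ RightComb-node⇔ _ a _ ⟩
  (iterate prune l (suc t) ≡ leaf × RightComb (iterate pruneOffArm r (suc t)))    ≈⟨ iterate-prune≡leaf⇔ t l ×-⇔ RightComb-iterate⇔ t r ⟩
  (rightDepth l ≤ t × offArmDepth r ≤ t)                                          ≈⟨ mk⇔ (λ (p , q) → ⊔-lub p q) (λ le → m⊔n≤o⇒m≤o _ _ le , m⊔n≤o⇒n≤o _ _ le) ⟩
  offArmDepth (node l a r) ≤ t                                                    ∎
  where open SetoidReasoning (⇔-setoid 0ℓ)

-- Longest restricted right paths

maxList-++ : ∀ xs ys → maxList (xs ++ ys) ≡ maxList xs ⊔ maxList ys
maxList-++ []       ys = refl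
maxList-++ (x ∷ xs) ys = trans (cong (x ⊔_) (maxList-++ xs ys)) (sym (⊔-assoc x _ _))

maxList-map-suc : ∀ x xs → maxList (map suc (x ∷ xs)) ≡ suc (maxList (x ∷ xs))
maxList-map-suc x []       = cong suc (sym (⊔-identityʳ x))
maxList-map-suc x (y ∷ ys) = cong (suc x ⊔_) (maxList-map-suc y ys)

maxRightEdges : List (List Dir) → ℕ
maxRightEdges ps = maxList (map rightEdges ps)

maxRightEdges-++ : ∀ ps qs → maxRightEdges (ps ++ qs) ≡ maxRightEdges ps ⊔ maxRightEdges qs
maxRightEdges-++ ps qs = trans (cong maxList (map-++ rightEdges ps qs)) (maxList-++ (map rightEdges ps) _)

maxRightEdges-concatMap-++ : ∀ ts us →
  maxRightEdges (concatMap pathsFrom (ts ++ us)) ≡ maxRightEdges (concatMap pathsFrom ts) ⊔ maxRightEdges (concatMap pathsFrom us)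
maxRightEdges-concatMap-++ ts us =
  trans (cong maxRightEdges (trans (cong concat (map-++ pathsFrom ts us)) (sym (concat-++ (map pathsFrom ts) _))))
        (maxRightEdges-++ (concatMap pathsFrom ts) _)

mutual
  maxRightEdges-pathsFrom : ∀ T → maxRightEdges (pathsFrom T) ≡ rightDepth T
  maxRightEdges-pathsFrom leaf         = refl
  maxRightEdges-pathsFrom (node l _ r) = begin
    maxRightEdges (map (L ∷_) (pathsFrom l) ++ map (R ∷_) (pathsFrom r))        ≡⟨ maxRightEdges-++ (map (L ∷_) (pathsFrom l)) _ ⟩
    maxRightEdges (map (L ∷_) (pathsFrom l)) ⊔ maxRightEdges (map (R ∷_) (pathsFrom r))
                                                                                ≡⟨ cong₂ _⊔_ (cong maxList (sym (map-∘ (pathsFrom l)))) refl ⟩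
    maxRightEdges (pathsFrom l) ⊔ maxRightEdges (map (R ∷_) (pathsFrom r))      ≡⟨ cong₂ _⊔_ (maxRightEdges-pathsFrom l) (maxRightEdges-pathsFromᴿ r) ⟩
    rightDepth l ⊔ rightDepthᴿ r                                                ∎
    where open ≡-Reasoning

  maxRightEdges-pathsFromᴿ : ∀ T → maxRightEdges (map (R ∷_) (pathsFrom T)) ≡ rightDepthᴿ T
  maxRightEdges-pathsFromᴿ leaf             = refl
  maxRightEdges-pathsFromᴿ T@(node l _ r) = begin
    maxList (map rightEdges (map (R ∷_) (pathsFrom T)))   ≡⟨ cong maxList (trans (sym (map-∘ (pathsFrom T))) (map-∘ (pathsFrom T))) ⟩
    maxList (map suc (map rightEdges (pathsFrom T)))     ≡⟨ maxList-map-suc 0 (map rightEdges (map (L ∷_) (pathsFrom l) ++ map (R ∷_) (pathsFrom r))) ⟩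
    suc (maxRightEdges (pathsFrom T))                    ≡⟨ cong suc (maxRightEdges-pathsFrom T) ⟩
    suc (rightDepth T)                                   ∎
    where open ≡-Reasoning

maxRightEdges-subtrees : ∀ T → maxRightEdges (concatMap pathsFrom (subtrees T)) ≡ rightDepth T
maxRightEdges-subtrees leaf           = refl
maxRightEdges-subtrees T@(node l _ r) = begin
  maxRightEdges (pathsFrom T ++ concatMap pathsFrom (subtrees l ++ subtrees r))
       ≡⟨ maxRightEdges-++ (pathsFrom T) _ ⟩
  maxRightEdges (pathsFrom T) ⊔ maxRightEdges (concatMap pathsFrom (subtrees l ++ subtrees r))
       ≡⟨ cong₂ _⊔_ (maxRightEdges-pathsFrom T) (maxRightEdges-concatMap-++ (subtrees l) (subtrees r)) ⟩
  rightDepth T ⊔ (maxRightEdges (concatMap pathsFrom (subtrees l)) ⊔ maxRightEdges (concatMap pathsFrom (subtrees r)))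
       ≡⟨ cong (λ d → rightDepth T ⊔ d) (cong₂ _⊔_ (maxRightEdges-subtrees l) (maxRightEdges-subtrees r)) ⟩
  rightDepth T ⊔ (rightDepth l ⊔ rightDepth r)
       ≡⟨ m≥n⇒m⊔n≡m (⊔-mono-≤ ≤-refl (rightDepth≤rightDepthᴿ r)) ⟩
  rightDepth T ∎
  where
  open ≡-Reasoning
  rightDepth≤rightDepthᴿ : ∀ T → rightDepth T ≤ rightDepthᴿ T
  rightDepth≤rightDepthᴿ leaf         = z≤n
  rightDepth≤rightDepthᴿ (node _ _ _) = n≤1+n _

maxRightEdges-restrictedPaths : ∀ T → maxRightEdges (restrictedPaths T) ≡ offArmDepth T
maxRightEdges-restrictedPaths leaf         = refl
maxRightEdges-restrictedPaths (node l _ r) =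
  trans (maxRightEdges-concatMap-++ (subtrees l) (offArm r))
        (cong₂ _⊔_ (maxRightEdges-subtrees l) (maxRightEdges-restrictedPaths r))

offArmDepth-noLeftEdge : ∀ T → hasLeftEdge T ≡ false → offArmDepth T ≡ 0
offArmDepth-noLeftEdge leaf            _  = refl
offArmDepth-noLeftEdge (node leaf _ r) eq = offArmDepth-noLeftEdge r eq

lrrp≤suc⇔ : ∀ T t → lrrp T ≤ suc t ⇔ offArmDepth T ≤ t
lrrp≤suc⇔ T t with hasLeftEdge T in eq
... | true  = mk⇔ (λ le → subst (_≤ t) (maxRightEdges-restrictedPaths T) (s≤s⁻¹ le))
                  (λ le → s≤s (subst (_≤ t) (sym (maxRightEdges-restrictedPaths T)) le))
... | false = mk⇔ (λ _ → subst (_≤ t) (sym (offArmDepth-noLeftEdge T eq)) z≤n) (λ _ → z≤n)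

-- The tree of a 213-avoiding permutation

private
  module Lam = Min.Recursion leaf (λ _ i _ l r → node l i r)

lamF≡recF : ∀ k w → lamF k w ≡ Lam.recF k w
lamF≡recF zero    _        = refl
lamF≡recF (suc k) []       = refl
lamF≡recF (suc k) (x ∷ xs) = cong₂ (λ l r → node l _ r) (lamF≡recF k _) (lamF≡recF k _)

lam≡rec : ∀ w → lam w ≡ Lam.rec w
lam≡rec w = lamF≡recF (length w) w

lam-split : ∀ α {i} β → i ∉ α → All (_≥ i) (α ++ i ∷ β) → lam (α ++ i ∷ β) ≡ node (lam α) i (lam β)
lam-split α {i} β i∉α i-bottom =
  trans (lam≡rec (α ++ i ∷ β))
    (trans (Lam.unfold α β i∉α i-bottom)
      (sym (cong₂ (λ l r → node l i r) (lam≡rec α) (lam≡rec β))))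

Avoids213-⊑ : ∀ {v w} → v ⊑ w → Avoids213 w → Avoids213 v
Avoids213-⊑ v⊑w avoids (a , b , c , abc⊑v , b<a , a<c) = avoids (a , b , c , Sublist.⊆-trans abc⊑v v⊑w , b<a , a<c)

lam-Layered : ∀ w → Unique w → Avoids213 w → inorder (lam w) ≡ w × Layered (lam w)
lam-Layered w = go (Min.view w)
  where
  go : ∀ {w} → Min.View w → Unique w → Avoids213 w → inorder (lam w) ≡ w × Layered (lam w)
  go Min.empty                                  _ _      = refl , leaf
  go (Min.split {α} {i} {β} i∉α i-bottom vα vβ) u avoids =
    let uα , uiβ , α≢iβ = AllPairs-++⁻ α u
        inorder-α , lay-α = go vα uα (Avoids213-⊑ (Sublistₚ.++⁺ʳ (i ∷ β) Sublist.⊆-refl) avoids)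
        inorder-β , lay-β = go vβ (AllPairs.tail uiβ) (Avoids213-⊑ (Sublistₚ.++⁺ˡ α (i Sublist.∷ʳ Sublist.⊆-refl)) avoids)
        i<α = above-min (All.++⁻ˡ α i-bottom) i∉α
        i<β = above-min (All.tail (All.++⁻ʳ α i-bottom)) (All¬⇒¬Any (AllPairs.head uiβ))
        -- y i z would be an occurrence of 213 if y < z
        β≪α = All.tabulate λ z∈β → All.tabulate λ y∈α →
          ≤∧≢⇒< (≮⇒≥ λ y<z → avoids (_ , i , _ , Sublistₚ.++⁺ (Sublist.from∈ y∈α) (refl Sublist.∷ Sublist.from∈ z∈β) ,
                                      All.lookup i<α y∈α , y<z))
                (λ z≡y → All.lookup (All.lookup α≢iβ y∈α) (there z∈β) (sym z≡y))
    in subst (λ T → inorder T ≡ α ++ i ∷ β × Layered T) (sym (lam-split α β i∉α i-bottom))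
         (cong₂ (λ l r → l ++ i ∷ r) inorder-α inorder-β ,
          node (subst (All (i <_)) (sym inorder-α) i<α) (subst (All (i <_)) (sym inorder-β) i<β)
               (subst₂ _≪_ (sym inorder-β) (sym inorder-α) β≪α) lay-α lay-β)

stackSortIter↭ : ∀ t w → stackSortIter t w ↭ w
stackSortIter↭ zero    w = ↭-refl
stackSortIter↭ (suc t) w = ↭-trans (stackSortIter↭ t (stackSort w)) (stackSort↭ w)

idPerm-increasing : ∀ n → Increasing (idPerm n)
idPerm-increasing n = AllPairsₚ.applyUpTo⁺₁ suc n (λ i<j _ → s≤s i<j)

IsPermOf⇒Unique : ∀ {n π} → IsPermOf n π → Unique π
IsPermOf⇒Unique {n} perm = Unique-resp-↭ (↭⇒↭ₛ (↭-sym perm)) (AllPairs.map <⇒≢ (idPerm-increasing n))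

sortable⇔increasing : ∀ t {n π} → IsPermOf n π → TStackSortable t n π ⇔ Increasing (stackSortIter t π)
sortable⇔increasing t {n} {π} perm = mk⇔
  (λ sorted → subst Increasing (sym sorted) (idPerm-increasing n))
  (λ ↑ → Increasing-↭-unique ↑ (idPerm-increasing n) (↭-trans (stackSortIter↭ t π) perm))

lemma2p1 : (t n : ℕ) (π : List ℕ) → 1 ≤ t → IsPermOf n π → Avoids213 π →
             (TStackSortable t n π ⇔ (lrrp (lam π) ≤ t))
lemma2p1 (suc t) n π _ perm avoids = begin
  TStackSortable (suc t) n π                              ≈⟨ sortable⇔increasing (suc t) perm ⟩
  Increasing (stackSortIter (suc t) π)                    ≡⟨ cong (Increasing ∘ stackSortIter (suc t)) (sym inorder-lam) ⟩
  Increasing (stackSortIter (suc t) (inorder (lam π)))    ≈⟨ sortable⇔RightComb (suc t) lay (subst Unique (sym inorder-lam) u) ⟩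
  RightComb (iterate pruneOffArm (lam π) (suc t))         ≈⟨ RightComb-iterate⇔ t (lam π) ⟩
  offArmDepth (lam π) ≤ t                                 ≈⟨ lrrp≤suc⇔ (lam π) t ⟨
  lrrp (lam π) ≤ suc t                                    ∎
  where
  open SetoidReasoning (⇔-setoid 0ℓ)
  u : Unique π
  u = IsPermOf⇒Unique perm
  inorder-lam : inorder (lam π) ≡ π
  inorder-lam = proj₁ (lam-Layered π u avoids)
  lay : Layered (lam π)
  lay = proj₂ (lam-Layered π u avoids)
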